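{- Let $n\geq 1$, let $p$ be a prime, and let $L\subset\mathbb{R}^n$ be a unimodular integral lattice which is a $p$-neighbor of ${\rm I}_n=\mathbb{Z}^n$ and whose visible root system ${\rm R}_2(L)\cap\mathbb{Z}^n$ is empty (this forces $p\geq 2n+1$). Then every characteristic vector $\xi$ of $L$ with $\xi\cdot\xi<n$ satisfies $\xi\cdot\xi\geq \frac{4n^3-n}{3p^2}$.
   Context: A unimodular integral lattice is a full-rank lattice $L\subset\mathbb{R}^n$ with $v\cdot w\in\mathbb{Z}$ for all $v,w\in L$ and covolume $1$. Such $L$ is a $p$-neighbor of $\mathbb{Z}^n$ if $L\cap\mathbb{Z}^n$ has index $p$ in $\mathbb{Z}^n$; equivalently $L={\rm M}_p(x)+\mathbb{Z}\frac{x'}{p}$ where $x\in\mathbb{Z}^n$ has coprime coordinates, ${\rm M}_p(x)=\{v\in\mathbb{Z}^n\,|\,\sum_i v_ix_i\equiv 0 \bmod p\}$, and $x'\in\mathbb{Z}^n$ with $x'\equiv x\bmod p$. ${\rm R}_2(L)=\{v\in L\,|\,v\cdot v=2\}$. A characteristic vector of $L$ is $\xi\in L$ with $\xi\cdot v\equiv v\cdot v\bmod 2$ for all $v\in L$. -}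

module Defs where

open import Data.Nat as ℕ using (ℕ; zero; suc)
open import Data.Nat.Divisibility as ℕD using ()
open import Data.Integer using (ℤ; +_; _+_; _*_; _-_; ∣_∣)
open import Data.Integer.Divisibility using (_∣_)
open import Data.Fin using (Fin; zero; suc)
open import Data.Product using (Σ; _×_; ∃₂)
open import Relation.Binary.PropositionalEquality using (_≡_)
open import Function using (_∘_)

Vecℤ : ℕ → Set
Vecℤ n = Fin n → ℤ

dot : ∀ {n} → Vecℤ n → Vecℤ n → ℤ
dot {zero}  _ _ = + 0
dot {suc n} v w = v zero * w zero + dot (v ∘ suc) (w ∘ suc)

CoprimeCoords : ∀ {n} → Vecℤ n → Set
CoprimeCoords x = ∀ (d : ℕ) → (∀ i → d ℕD.∣ ∣ x i ∣) → d ≡ 1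

CongMod : ∀ {n} → ℕ → Vecℤ n → Vecℤ n → Set
CongMod p x' x = ∀ i → + p ∣ (x' i - x i)

InMp : ∀ {n} → ℕ → Vecℤ n → Vecℤ n → Set
InMp p x v = + p ∣ dot v x

-- Scaled coordinates: every element of L = M_p(x) + ℤ x'/p lies in (1/p)ℤ^n.
-- A vector u ∈ (1/p)ℤ^n is represented by y = p·u ∈ ℤ^n.
-- InL p x x' y  ⇔  y/p ∈ M_p(x) + ℤ (x'/p),  i.e. y = p·m + k·x' with m ∈ M_p(x), k ∈ ℤ.
InL : ∀ {n} → ℕ → Vecℤ n → Vecℤ n → Vecℤ n → Set
InL p x x' y = ∃₂ λ (m : Vecℤ _) (k : ℤ) → InMp p x m × (∀ i → y i ≡ + p * m i + k * x' i)

-- L is integral: (y/p)·(z/p) ∈ ℤ for all y/p, z/p ∈ L, i.e. p² ∣ y·z.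
Integral : ∀ {n} → ℕ → Vecℤ n → Vecℤ n → Set
Integral {n} p x x' = ∀ (y z : Vecℤ n) → InL p x x' y → InL p x x' z → + (p ℕ.* p) ∣ dot y z

-- The visible root system R₂(L) ∩ ℤ^n is empty: no v ∈ ℤ^n with v ∈ L and v·v = 2.
-- (v ∈ L in scaled coordinates means p·v satisfies InL.)
NoVisibleRoots : ∀ {n} → ℕ → Vecℤ n → Vecℤ n → Set
NoVisibleRoots {n} p x x' =
  ∀ (v : Vecℤ n) → InL p x x' (λ i → + p * v i) → dot v v ≡ + 2 → Data.Empty.⊥
  where import Data.Empty

-- ξ = y/p is a characteristic vector of L: ξ ∈ L and ξ·v ≡ v·v (mod 2) for all v = z/p ∈ L,
-- i.e. (z·z − y·z)/p² is even, i.e. 2p² ∣ z·z − y·z.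
Characteristic : ∀ {n} → ℕ → Vecℤ n → Vecℤ n → Vecℤ n → Set
Characteristic {n} p x x' y =
  InL p x x' y × (∀ (z : Vecℤ n) → InL p x x' z → + (2 ℕ.* p ℕ.* p) ∣ (dot z z - dot y z))

-- In the scaled coordinates of Defs, ξ = p·m + k·x′ with m ∈ Mₚ(x). Testing the characteristic
-- property against p²·eᵢ ∈ L gives ξᵢ ≡ p² (mod 2), so for odd p every ξᵢ is odd, in particular
-- nonzero. If p ∣ k then p ∣ ξᵢ for all i and ξ·ξ ≥ np²; hence p ∤ k. Then ξᵢ = ±ξⱼ with i ≠ j
-- would give p ∣ x′ᵢ ± x′ⱼ, i.e. eᵢ ± eⱼ ∈ Mₚ(x) would be a visible root. So the |ξᵢ| are n
-- distinct odd numbers and ξ·ξ ≥ 1² + 3² + ⋯ + (2n−1)² = (4n³ − n)/3.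
-- For p = 2 the hypotheses are inconsistent: coprimality and the absence of visible roots leave
-- x′ with exactly one odd coordinate, so x′·x′ ≢ 0 (mod 4), whereas x′/2 ∈ L must have integral norm.
module Submission where

open import Defs

open import Data.Empty using (⊥; ⊥-elim)
open import Data.Fin using (Fin; zero; suc; punchIn; fromℕ<; toℕ)
import Data.Fin.Properties as Finₚ
open import Data.Integer as ℤ using (ℤ; +_; -[1+_]; _+_; _*_; _-_; -_; ∣_∣; _≤_; _<_)
import Data.Integer.DivMod as ℤ
import Data.Integer.Divisibility as ℤᵤ
open import Data.Integer.Divisibility.Signed
open import Data.Integer.Properties
open import Data.Integer.Tactic.RingSolver using (solve-∀)
open import Data.Nat as ℕ using (ℕ; zero; suc; z≤n; s≤s)
open import Data.Nat.Divisibility as ℕ∣ using () renaming (_∣_ to _∣ℕ_)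
open import Data.Nat.Primality using (Prime; euclidsLemma; prime⇒irreducible; prime⇒nonZero; prime[2])
import Data.Nat.Properties as ℕₚ
import Data.Nat.Tactic.RingSolver as ℕRing
open import Algebra.Properties.CommutativeMonoid.Sum ℕₚ.+-0-commutativeMonoid
  using (sum; sum-remove; sum-cong-≗)
open import Data.Product using (∃-syntax; _×_; _,_; proj₁; proj₂)
open import Data.Sum using (_⊎_; inj₁; inj₂; reduce; fromInj₂)
open import Function using (_∘_)
open import Function.Definitions using (Injective)
open import Relation.Binary.PropositionalEquality
open import Relation.Nullary using (¬_; yes; no; contradiction)

∣-sum : ∀ {n d} (f : Fin n → ℕ) → (∀ i → d ∣ℕ f i) → d ∣ℕ sum f
∣-sum {zero} {d} f d∣f = d ℕ∣.∣0
∣-sum {suc n} f d∣f = ℕ∣.∣m∣n⇒∣m+n (d∣f zero) (∣-sum (f ∘ suc) (d∣f ∘ suc))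

*≤sum : ∀ {n c} (f : Fin n → ℕ) → (∀ i → c ℕ.≤ f i) → n ℕ.* c ℕ.≤ sum f
*≤sum {zero}  f c≤f = z≤n
*≤sum {suc n} f c≤f = ℕₚ.+-mono-≤ (c≤f zero) (*≤sum (f ∘ suc) (c≤f ∘ suc))

sumBelow : (ℕ → ℕ) → ℕ → ℕ
sumBelow h zero    = 0
sumBelow h (suc n) = sumBelow h n ℕ.+ h n

sumBelow≤sum∘injective : ∀ {n} (h : ℕ → ℕ) → (∀ {a b} → a ℕ.≤ b → h a ℕ.≤ h b) →
  (g : Fin n → ℕ) → Injective _≡_ _≡_ g → sumBelow h n ℕ.≤ sum (h ∘ g)
sumBelow≤sum∘injective {zero}  h h-mono g g-inj = z≤n
sumBelow≤sum∘injective {suc n} h h-mono g g-inj with Finₚ.any? (λ j → n ℕ.≤? g j)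
... | yes (j , n≤gj) = begin
  sumBelow h n ℕ.+ h n                ≤⟨ ℕₚ.+-mono-≤ IH (h-mono n≤gj) ⟩
  sum (h ∘ g ∘ punchIn j) ℕ.+ h (g j)  ≡⟨ ℕₚ.+-comm _ (h (g j)) ⟩
  h (g j) ℕ.+ sum (h ∘ g ∘ punchIn j)  ≡⟨ sum-remove (h ∘ g) ⟨
  sum (h ∘ g)                         ∎
  where
  open ℕₚ.≤-Reasoning
  IH : sumBelow h n ℕ.≤ sum (h ∘ g ∘ punchIn j)
  IH = sumBelow≤sum∘injective h h-mono (g ∘ punchIn j) (Finₚ.punchIn-injective j _ _ ∘ g-inj)
... | no ∄j = contradiction (Finₚ.injective⇒≤ g<n-injective) ℕₚ.1+n≰n
  where
  g<n : Fin (suc n) → Fin n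
  g<n i = fromℕ< (ℕₚ.≰⇒> (∄j ∘ (i ,_)))
  g<n-injective : Injective _≡_ _≡_ g<n
  g<n-injective {i} {k} eq = g-inj (begin
    g i           ≡⟨ Finₚ.toℕ-fromℕ< _ ⟨
    toℕ (g<n i)   ≡⟨ cong toℕ eq ⟩
    toℕ (g<n k)   ≡⟨ Finₚ.toℕ-fromℕ< _ ⟩
    g k           ∎)
    where open ≡-Reasoning

oddSquare : ℕ → ℕ
oddSquare k = suc (2 ℕ.* k) ℕ.* suc (2 ℕ.* k)

oddSquare-mono : ∀ {a b} → a ℕ.≤ b → oddSquare a ℕ.≤ oddSquare b
oddSquare-mono {a} {b} a≤b = ℕₚ.*-mono-≤ 2a+1≤2b+1 2a+1≤2b+1
  where
  2a+1≤2b+1 : suc (2 ℕ.* a) ℕ.≤ suc (2 ℕ.* b)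
  2a+1≤2b+1 = s≤s (ℕₚ.*-monoʳ-≤ 2 a≤b)

sumBelow-oddSquare : ∀ n → 3 ℕ.* sumBelow oddSquare n ℕ.+ n ≡ 4 ℕ.* (n ℕ.* n ℕ.* n)
sumBelow-oddSquare zero    = refl
sumBelow-oddSquare (suc n) = begin
  3 ℕ.* (sumBelow oddSquare n ℕ.+ oddSquare n) ℕ.+ suc n
    ≡⟨ regroup (sumBelow oddSquare n) n ⟩
  (3 ℕ.* sumBelow oddSquare n ℕ.+ n) ℕ.+ (3 ℕ.* oddSquare n ℕ.+ 1)
    ≡⟨ cong (ℕ._+ (3 ℕ.* oddSquare n ℕ.+ 1)) (sumBelow-oddSquare n) ⟩
  4 ℕ.* (n ℕ.* n ℕ.* n) ℕ.+ (3 ℕ.* oddSquare n ℕ.+ 1)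
    ≡⟨ cube-step n ⟩
  4 ℕ.* (suc n ℕ.* suc n ℕ.* suc n) ∎
  where
  open ≡-Reasoning
  regroup : ∀ s n → 3 ℕ.* (s ℕ.+ (1 ℕ.+ 2 ℕ.* n) ℕ.* (1 ℕ.+ 2 ℕ.* n)) ℕ.+ (1 ℕ.+ n)
                  ≡ (3 ℕ.* s ℕ.+ n) ℕ.+ (3 ℕ.* ((1 ℕ.+ 2 ℕ.* n) ℕ.* (1 ℕ.+ 2 ℕ.* n)) ℕ.+ 1)
  regroup = ℕRing.solve-∀
  cube-step : ∀ n → 4 ℕ.* (n ℕ.* n ℕ.* n) ℕ.+ (3 ℕ.* ((1 ℕ.+ 2 ℕ.* n) ℕ.* (1 ℕ.+ 2 ℕ.* n)) ℕ.+ 1)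
                  ≡ 4 ℕ.* ((1 ℕ.+ n) ℕ.* (1 ℕ.+ n) ℕ.* (1 ℕ.+ n))
  cube-step = ℕRing.solve-∀

odd⇒≡1+2* : ∀ {a} → ¬ 2 ∣ℕ a → ∃[ q ] a ≡ suc (2 ℕ.* q)
odd⇒≡1+2* {zero}        ¬2∣a = contradiction (2 ℕ∣.∣0) ¬2∣a
odd⇒≡1+2* {suc zero}    ¬2∣a = 0 , refl
odd⇒≡1+2* {suc (suc a)} ¬2∣a with odd⇒≡1+2* (¬2∣a ∘ ℕ∣.∣m∣n⇒∣m+n ℕ∣.∣-refl)
... | q , refl = suc q , cong (2 ℕ.+_) (sym (ℕₚ.+-suc q (q ℕ.+ 0)))

distinct-odd-squares : ∀ {n} (a : Fin n → ℕ) → (∀ i → ¬ 2 ∣ℕ a i) → Injective _≡_ _≡_ a →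
  4 ℕ.* (n ℕ.* n ℕ.* n) ℕ.≤ 3 ℕ.* sum (λ i → a i ℕ.* a i) ℕ.+ n
distinct-odd-squares {n} a a-odd a-inj = begin
  4 ℕ.* (n ℕ.* n ℕ.* n)                    ≡⟨ sumBelow-oddSquare n ⟨
  3 ℕ.* sumBelow oddSquare n ℕ.+ n          ≤⟨ ℕₚ.+-monoˡ-≤ n (ℕₚ.*-monoʳ-≤ 3 lower-bound) ⟩
  3 ℕ.* sum (oddSquare ∘ half) ℕ.+ n       ≡⟨ cong (λ s → 3 ℕ.* s ℕ.+ n) (sum-cong-≗ squares) ⟩
  3 ℕ.* sum (λ i → a i ℕ.* a i) ℕ.+ n       ∎
  where
  open ℕₚ.≤-Reasoning
  half : Fin n → ℕ
  half i = proj₁ (odd⇒≡1+2* (a-odd i))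
  a≡1+2*half : ∀ i → a i ≡ suc (2 ℕ.* half i)
  a≡1+2*half i = proj₂ (odd⇒≡1+2* (a-odd i))
  squares : ∀ i → oddSquare (half i) ≡ a i ℕ.* a i
  squares i = cong (λ t → t ℕ.* t) (sym (a≡1+2*half i))
  half-injective : Injective _≡_ _≡_ half
  half-injective {i} {j} eq =
    a-inj (trans (a≡1+2*half i) (trans (cong (λ h → 1 ℕ.+ 2 ℕ.* h) eq) (sym (a≡1+2*half j))))
  lower-bound : sumBelow oddSquare n ℕ.≤ sum (oddSquare ∘ half)
  lower-bound = sumBelow≤sum∘injective oddSquare oddSquare-mono half half-injective

dot-comm : ∀ {n} (u v : Vecℤ n) → dot u v ≡ dot v u
dot-comm {zero}  u v = refl
dot-comm {suc n} u v = cong₂ _+_ (*-comm (u zero) (v zero)) (dot-comm (u ∘ suc) (v ∘ suc))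

dot-zeroʳ : ∀ {n} (u : Vecℤ n) → dot u (λ _ → + 0) ≡ + 0
dot-zeroʳ {zero}  u = refl
dot-zeroʳ {suc n} u = cong₂ _+_ (*-zeroʳ (u zero)) (dot-zeroʳ (u ∘ suc))

dot-+ʳ : ∀ {n} (u v w : Vecℤ n) → dot u (λ i → v i + w i) ≡ dot u v + dot u w
dot-+ʳ {zero}  u v w = refl
dot-+ʳ {suc n} u v w =
  trans (cong (λ t → u zero * (v zero + w zero) + t) (dot-+ʳ (u ∘ suc) (v ∘ suc) (w ∘ suc)))
  (interchange (u zero) (v zero) (w zero) (dot (u ∘ suc) (v ∘ suc)) (dot (u ∘ suc) (w ∘ suc)))
  where
  interchange : ∀ a b c d e → a * (b + c) + (d + e) ≡ (a * b + d) + (a * c + e)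
  interchange = solve-∀

norm² : ∀ {n} → Vecℤ n → ℕ
norm² v = sum (λ i → ∣ v i ∣ ℕ.* ∣ v i ∣)

dot-self : ∀ {n} (v : Vecℤ n) → dot v v ≡ + norm² v
dot-self {zero}  v = refl
dot-self {suc n} v = begin
  v zero * v zero + dot (v ∘ suc) (v ∘ suc)
    ≡⟨ cong₂ _+_ (abs-square (v zero)) (dot-self (v ∘ suc)) ⟩
  + (∣ v zero ∣ ℕ.* ∣ v zero ∣) + + norm² (v ∘ suc)
    ≡⟨ pos-+ (∣ v zero ∣ ℕ.* ∣ v zero ∣) _ ⟨
  + norm² v ∎
  where
  open ≡-Reasoning
  abs-square : ∀ a → a * a ≡ + (∣ a ∣ ℕ.* ∣ a ∣)
  abs-square (+ a)    = sym (pos-* a a)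
  abs-square -[1+ a ] = refl

single : ∀ {n} → Fin n → ℤ → Vecℤ n
single zero    c zero    = c
single zero    c (suc _) = + 0
single (suc i) c zero    = + 0
single (suc i) c (suc j) = single i c j

single-self : ∀ {n} (i : Fin n) c → single i c i ≡ c
single-self zero    c = refl
single-self (suc i) c = single-self i c

single-other : ∀ {n} {i j : Fin n} c → i ≢ j → single i c j ≡ + 0
single-other {i = zero}  {zero}  c i≢j = contradiction refl i≢j
single-other {i = zero}  {suc j} c i≢j = refl
single-other {i = suc i} {zero}  c i≢j = refl
single-other {i = suc i} {suc j} c i≢j = single-other c (i≢j ∘ cong suc)

*-single : ∀ {n} a (i j : Fin n) c → a * single i c j ≡ single i (a * c) j
*-single a zero    zero    c = refl
*-single a zero    (suc j) c = *-zeroʳ a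
*-single a (suc i) zero    c = *-zeroʳ a
*-single a (suc i) (suc j) c = *-single a i j c

dot-singleʳ : ∀ {n} (u : Vecℤ n) i c → dot u (single i c) ≡ u i * c
dot-singleʳ {suc n} u zero    c = trans (cong (λ t → u zero * c + t) (dot-zeroʳ (u ∘ suc))) (+-identityʳ _)
dot-singleʳ {suc n} u (suc i) c =
  trans (cong₂ _+_ (*-zeroʳ (u zero)) (dot-singleʳ (u ∘ suc) i c)) (+-identityˡ _)

odd⇒≡1+2*ℤ : ∀ a → ¬ 2 ∣ℕ ∣ a ∣ → ∃[ q ] a ≡ + 1 + q * + 2
odd⇒≡1+2*ℤ a ¬2∣a with a ℤ.% + 2 | ℤ.n%d<d a (+ 2) | ℤ.a≡a%n+[a/n]*n a (+ 2)
... | 0 | _ | a≡0+q*2 = contradiction (∣⇒∣ᵤ (divides (a ℤ./ + 2) (trans a≡0+q*2 (+-identityˡ _)))) ¬2∣a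
... | 1 | _ | a≡1+q*2 = a ℤ./ + 2 , a≡1+q*2
... | suc (suc _) | s≤s (s≤s ()) | _

odd-square≢0-mod-4 : ∀ {a} → ¬ 2 ∣ℕ a → ¬ 4 ∣ℕ a ℕ.* a
odd-square≢0-mod-4 ¬2∣a 4∣a² with odd⇒≡1+2* ¬2∣a
... | q , refl = contradiction (ℕ∣.∣⇒≤ 4∣1) (λ { (s≤s ()) })
  where
  square : ∀ q → suc (2 ℕ.* q) ℕ.* suc (2 ℕ.* q) ≡ 4 ℕ.* (q ℕ.+ q ℕ.* q) ℕ.+ 1
  square = ℕRing.solve-∀
  4∣1 : 4 ∣ℕ 1
  4∣1 = ℕ∣.∣m+n∣m⇒∣n (subst (4 ∣ℕ_) (square q) 4∣a²) (ℕ∣.m∣m*n (q ℕ.+ q ℕ.* q))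

∣∣≡⇒≡⊎≡- : ∀ a b → ∣ a ∣ ≡ ∣ b ∣ → a ≡ b ⊎ a ≡ - b
∣∣≡⇒≡⊎≡- (+ a)    (+ b)    refl = inj₁ refl
∣∣≡⇒≡⊎≡- (+ a)    -[1+ b ] refl = inj₂ refl
∣∣≡⇒≡⊎≡- -[1+ a ] (+ b)    refl = inj₂ refl
∣∣≡⇒≡⊎≡- -[1+ a ] -[1+ b ] refl = inj₁ refl

∣∣≡⇒+±≡0 : ∀ a b → ∣ a ∣ ≡ ∣ b ∣ → ∃[ s ] s * s ≡ + 1 × a + s * b ≡ + 0
∣∣≡⇒+±≡0 a b ∣a∣≡∣b∣ with ∣∣≡⇒≡⊎≡- a b ∣a∣≡∣b∣
... | inj₁ refl = - + 1 , refl , trans (cong (λ t → a + t) (-1*i≡-i a)) (+-inverseʳ a)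
... | inj₂ refl = + 1 , refl , trans (cong (λ t → - b + t) (*-identityˡ b)) (+-inverseˡ b)

euclidsLemmaℤ : ∀ {p} → Prime p → ∀ a b → (+ p ∣ a * b) → (+ p ∣ a) ⊎ (+ p ∣ b)
euclidsLemmaℤ p-prime a b p∣ab with euclidsLemma ∣ a ∣ ∣ b ∣ p-prime (subst (_ ∣ℕ_) (abs-* a b) (∣⇒∣ᵤ p∣ab))
... | inj₁ p∣a = inj₁ (∣ᵤ⇒∣ p∣a)
... | inj₂ p∣b = inj₂ (∣ᵤ⇒∣ p∣b)

prime≢2⇒¬2∣p*p : ∀ {p} → Prime p → p ≢ 2 → ¬ 2 ∣ℕ p ℕ.* p
prime≢2⇒¬2∣p*p {p} p-prime p≢2 2∣p*p
  with prime⇒irreducible p-prime (reduce (euclidsLemma p p prime[2] 2∣p*p))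
... | inj₂ 2≡p = p≢2 (sym 2≡p)

Mp⊆L : ∀ {n p} {x x' m y : Vecℤ n} → InMp p x m → (∀ i → y i ≡ + p * m i) → InL p x x' y
Mp⊆L {p = p} {x' = x'} {m} m∈Mp y≡pm =
  m , + 0 , m∈Mp ,
  λ i → trans (y≡pm i) (sym (trans (cong (λ t → + p * m i + t) (*-zeroˡ (x' i))) (+-identityʳ _)))

x'∈L : ∀ {n} p (x x' : Vecℤ n) → InL p x x' x'
x'∈L p x x' = (λ _ → + 0) , + 1 , 0∈Mp , λ i → sym (drop-zero (+ p) (x' i))
  where
  0∈Mp : InMp p x (λ _ → + 0)
  0∈Mp = subst (λ t → p ∣ℕ ∣ t ∣) (sym (trans (dot-comm _ x) (dot-zeroʳ x))) (p ℕ∣.∣0)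
  drop-zero : ∀ a b → a * + 0 + + 1 * b ≡ b
  drop-zero = solve-∀

∣x'+sx'⇒∣x+sx : ∀ {n p} {x x' : Vecℤ n} → CongMod p x' x → ∀ i j s →
  (+ p ∣ x' i + s * x' j) → (+ p ∣ x i + s * x j)
∣x'+sx'⇒∣x+sx {p = p} {x} {x'} x'≡x i j s p∣ =
  subst (+ p ∣_) (shift (x i) (x j) (x' i) (x' j) s)
    (∣m∣n⇒∣m-n p∣ (∣m∣n⇒∣m+n (∣ᵤ⇒∣ {i = x' i - x i} (x'≡x i)) (∣n⇒∣m*n s (∣ᵤ⇒∣ {i = x' j - x j} (x'≡x j)))))
  where
  shift : ∀ a b a' b' s → (a' + s * b') - ((a' - a) + s * (b' - b)) ≡ a + s * b
  shift = solve-∀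

noVisibleRoots⇒∤x'+sx' : ∀ {n p} {x x' : Vecℤ n} → NoVisibleRoots p x x' → CongMod p x' x →
  ∀ {i j} → i ≢ j → ∀ s → s * s ≡ + 1 → ¬ (+ p ∣ x' i + s * x' j)
noVisibleRoots⇒∤x'+sx' {p = p} {x} {x'} noRoots x'≡x {i} {j} i≢j s s²≡1 p∣ =
  noRoots v (Mp⊆L v∈Mp (λ _ → refl)) v·v≡2
  where
  v : Vecℤ _
  v l = single i (+ 1) l + single j s l
  dot-v : ∀ u → dot u v ≡ u i + u j * s
  dot-v u = trans (dot-+ʳ u (single i (+ 1)) (single j s))
                  (cong₂ _+_ (trans (dot-singleʳ u i (+ 1)) (*-identityʳ (u i))) (dot-singleʳ u j s))
  v∈Mp : InMp p x v
  v∈Mp = ∣⇒∣ᵤ (subst (+ p ∣_) v·x≡xᵢ+sxⱼ (∣x'+sx'⇒∣x+sx {x = x} {x'} x'≡x i j s p∣))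
    where
    v·x≡xᵢ+sxⱼ : x i + s * x j ≡ dot v x
    v·x≡xᵢ+sxⱼ = sym (trans (dot-comm v x) (trans (dot-v x) (cong (_+_ (x i)) (*-comm (x j) s))))
  vᵢ≡1 : v i ≡ + 1
  vᵢ≡1 = trans (cong₂ _+_ (single-self i (+ 1)) (single-other s (i≢j ∘ sym))) (+-identityʳ (+ 1))
  vⱼ≡s : v j ≡ s
  vⱼ≡s = trans (cong₂ _+_ (single-other (+ 1) i≢j) (single-self j s)) (+-identityˡ s)
  v·v≡2 : dot v v ≡ + 2
  v·v≡2 = trans (dot-v v) (trans (cong₂ _+_ vᵢ≡1 (cong (_* s) vⱼ≡s)) (cong (_+_ (+ 1)) s²≡1))

characteristic⇒odd : ∀ {n p} {x x' ξ : Vecℤ n} → Prime p → p ≢ 2 →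
  Characteristic p x x' ξ → ∀ i → ¬ 2 ∣ℕ ∣ ξ i ∣
characteristic⇒odd {p = p} {x} {x'} {ξ} p-prime p≢2 (_ , char) i 2∣ξᵢ =
  prime≢2⇒¬2∣p*p p-prime p≢2 (∣⇒∣ᵤ 2∣P)
  where
  instance
    P≢0 : ℤ.NonZero (+ (p ℕ.* p))
    P≢0 = ℕₚ.m*n≢0 p p {{prime⇒nonZero p-prime}} {{prime⇒nonZero p-prime}}
  P : ℤ
  P = + (p ℕ.* p)
  pe : Vecℤ _
  pe = single i (+ p)
  pe∈Mp : InMp p x pe
  pe∈Mp = ∣⇒∣ᵤ (subst (+ p ∣_) (sym (trans (dot-comm pe x) (dot-singleʳ x i (+ p)))) (∣n⇒∣m*n (x i) ∣-refl))
  Pe∈L : InL p x x' (single i P)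
  Pe∈L = Mp⊆L pe∈Mp (λ j → trans (cong (λ c → single i c j) (pos-* p p)) (sym (*-single (+ p) i j (+ p))))
  char-at-Pe : + 2 * P ∣ (P - ξ i) * P
  char-at-Pe = ∣ᵤ⇒∣ (subst₂ ℤᵤ._∣_ 2*p*p≡2*P (char-difference) (char (single i P) Pe∈L))
    where
    2*p*p≡2*P : + (2 ℕ.* p ℕ.* p) ≡ + 2 * P
    2*p*p≡2*P = trans (cong +_ (ℕₚ.*-assoc 2 p p)) (pos-* 2 (p ℕ.* p))
    factor : ∀ a b → a * a - b * a ≡ (a - b) * a
    factor = solve-∀
    char-difference : dot (single i P) (single i P) - dot ξ (single i P) ≡ (P - ξ i) * P
    char-difference = trans (cong₂ _-_ (trans (dot-singleʳ (single i P) i P) (cong (_* P) (single-self i P)))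
                                       (dot-singleʳ ξ i P))
                            (factor P (ξ i))
  2∣P : + 2 ∣ P
  2∣P = subst (+ 2 ∣_) (minus-plus P (ξ i))
              (∣m∣n⇒∣m+n (*-cancelʳ-∣ P {j = P - ξ i} char-at-Pe) (∣ᵤ⇒∣ {i = ξ i} 2∣ξᵢ))
    where
    minus-plus : ∀ a b → (a - b) + b ≡ a
    minus-plus = solve-∀

norm<np²⇒p∤k : ∀ {n p} {m x' ξ : Vecℤ n} {k} → (∀ i → ξ i ≡ + p * m i + k * x' i) →
  (∀ i → ¬ 2 ∣ℕ ∣ ξ i ∣) → dot ξ ξ < + (n ℕ.* p ℕ.* p) → ¬ (+ p ∣ k)
norm<np²⇒p∤k {n} {p} {m} {x'} {ξ} {k} ξ≡pm+kx' ξ-odd short p∣k =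
  ℕₚ.<⇒≱ norm<np² (*≤sum _ (λ i → ℕₚ.*-mono-≤ (p≤∣ξ∣ i) (p≤∣ξ∣ i)))
  where
  norm<np² : norm² ξ ℕ.< n ℕ.* (p ℕ.* p)
  norm<np² = subst (norm² ξ ℕ.<_) (ℕₚ.*-assoc n p p)
                   (drop‿+<+ (subst (_< + (n ℕ.* p ℕ.* p)) (dot-self ξ) short))
  ξ≢0 : ∀ i → ∣ ξ i ∣ ≢ 0
  ξ≢0 i ∣ξᵢ∣≡0 = ξ-odd i (subst (2 ∣ℕ_) (sym ∣ξᵢ∣≡0) (2 ℕ∣.∣0))
  p∣ξ : ∀ i → p ∣ℕ ∣ ξ i ∣
  p∣ξ i = ∣⇒∣ᵤ (subst (+ p ∣_) (sym (ξ≡pm+kx' i)) (∣m∣n⇒∣m+n (∣m⇒∣m*n (m i) ∣-refl) (∣m⇒∣m*n (x' i) p∣k)))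
  p≤∣ξ∣ : ∀ i → p ℕ.≤ ∣ ξ i ∣
  p≤∣ξ∣ i = ℕ∣.∣⇒≤ {{ℕ.≢-nonZero (ξ≢0 i)}} (p∣ξ i)

∣ξ∣-injective : ∀ {n p} {x x' m ξ : Vecℤ n} {k} → Prime p → NoVisibleRoots p x x' → CongMod p x' x →
  (∀ i → ξ i ≡ + p * m i + k * x' i) → ¬ (+ p ∣ k) → Injective _≡_ _≡_ (∣_∣ ∘ ξ)
∣ξ∣-injective {p = p} {x} {x'} {m} {ξ} {k} p-prime noRoots x'≡x ξ≡pm+kx' p∤k {i} {j} ∣ξᵢ∣≡∣ξⱼ∣
  with i Finₚ.≟ j | ∣∣≡⇒+±≡0 (ξ i) (ξ j) ∣ξᵢ∣≡∣ξⱼ∣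
... | yes i≡j | _                     = i≡j
... | no i≢j  | s , s²≡1 , ξᵢ+sξⱼ≡0 =
  ⊥-elim (noVisibleRoots⇒∤x'+sx' noRoots x'≡x i≢j s s²≡1
            (fromInj₂ (⊥-elim ∘ p∤k) (euclidsLemmaℤ p-prime k _ p∣k*x')))
  where
  regroup : ∀ P mi mj k xi xj s →
    (P * mi + k * xi) + s * (P * mj + k * xj) ≡ P * (mi + s * mj) + k * (xi + s * xj)
  regroup = solve-∀
  0≡pM+kX : + 0 ≡ + p * (m i + s * m j) + k * (x' i + s * x' j)
  0≡pM+kX = trans (sym ξᵢ+sξⱼ≡0) (trans (cong₂ (λ a b → a + s * b) (ξ≡pm+kx' i) (ξ≡pm+kx' j))
                                         (regroup (+ p) (m i) (m j) k (x' i) (x' j) s))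
  p∣k*x' : + p ∣ k * (x' i + s * x' j)
  p∣k*x' = ∣m+n∣m⇒∣n (subst (+ p ∣_) 0≡pM+kX (divides (+ 0) refl)) (∣m⇒∣m*n (m i + s * m j) ∣-refl)

one-odd⇒¬4∣norm : ∀ {n} (v : Vecℤ n) i₀ → ¬ 2 ∣ℕ ∣ v i₀ ∣ → (∀ j → j ≢ i₀ → 2 ∣ℕ ∣ v j ∣) →
  ¬ 4 ∣ℕ ∣ dot v v ∣
one-odd⇒¬4∣norm {suc n} v i₀ vᵢ₀-odd v-even 4∣norm = odd-square≢0-mod-4 vᵢ₀-odd 4∣vᵢ₀²
  where
  square : Fin (suc n) → ℕ
  square i = ∣ v i ∣ ℕ.* ∣ v i ∣
  4∣others : 4 ∣ℕ sum (square ∘ punchIn i₀)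
  4∣others = ∣-sum _ λ j →
    let 2∣vⱼ = v-even (punchIn i₀ j) (Finₚ.punchInᵢ≢i i₀ j) in ℕ∣.*-pres-∣ 2∣vⱼ 2∣vⱼ
  4∣sum : 4 ∣ℕ square i₀ ℕ.+ sum (square ∘ punchIn i₀)
  4∣sum = subst (4 ∣ℕ_) (trans (cong ∣_∣ (dot-self v)) (sum-remove square)) 4∣norm
  4∣vᵢ₀² : 4 ∣ℕ square i₀
  4∣vᵢ₀² = ℕ∣.∣m+n∣m⇒∣n (subst (4 ∣ℕ_) (ℕₚ.+-comm (square i₀) _) 4∣sum) 4∣others

noVisibleRoots₂⇒⊥ : ∀ {n} {x x' : Vecℤ n} → CoprimeCoords x → CongMod 2 x' x →
  Integral 2 x x' → NoVisibleRoots 2 x x' → ⊥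
noVisibleRoots₂⇒⊥ {n} {x} {x'} coprime x'≡x integral noRoots with Finₚ.all? (λ i → 2 ℕ∣.∣? ∣ x' i ∣)
... | yes x'-even = contradiction (coprime 2 x-even) (λ ())
  where
  back : ∀ a b → a - (a - b) ≡ b
  back = solve-∀
  x-even : ∀ i → 2 ∣ℕ ∣ x i ∣
  x-even i = ∣⇒∣ᵤ (subst (+ 2 ∣_) (back (x' i) (x i))
                     (∣m∣n⇒∣m-n (∣ᵤ⇒∣ {i = x' i} (x'-even i)) (∣ᵤ⇒∣ {i = x' i - x i} (x'≡x i))))
... | no ¬x'-even with Finₚ.¬∀⟶∃¬ n _ (λ i → 2 ℕ∣.∣? ∣ x' i ∣) ¬x'-even
... | i₀ , x'ᵢ₀-odd =
  one-odd⇒¬4∣norm x' i₀ x'ᵢ₀-odd x'-even (integral x' x' (x'∈L 2 x x') (x'∈L 2 x x'))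
  where
  x'-even : ∀ j → j ≢ i₀ → 2 ∣ℕ ∣ x' j ∣
  x'-even j j≢i₀ with 2 ℕ∣.∣? ∣ x' j ∣
  ... | yes 2∣x'ⱼ = 2∣x'ⱼ
  ... | no x'ⱼ-odd = ⊥-elim (noVisibleRoots⇒∤x'+sx' noRoots x'≡x (j≢i₀ ∘ sym) (- + 1) refl 2∣x'ᵢ₀-x'ⱼ)
    where
    odd-difference : ∀ a b → (+ 1 + a * + 2) + - + 1 * (+ 1 + b * + 2) ≡ (a - b) * + 2
    odd-difference = solve-∀
    2∣x'ᵢ₀-x'ⱼ : + 2 ∣ x' i₀ + - + 1 * x' j
    2∣x'ᵢ₀-x'ⱼ with odd⇒≡1+2*ℤ (x' i₀) x'ᵢ₀-odd | odd⇒≡1+2*ℤ (x' j) x'ⱼ-odd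
    ... | q , x'ᵢ₀≡ | r , x'ⱼ≡ =
      divides (q - r) (trans (cong₂ (λ a b → a + - + 1 * b) x'ᵢ₀≡ x'ⱼ≡) (odd-difference q r))

characteristic-norm-bound : ∀ {n p} {x x' ξ : Vecℤ n} → Prime p → p ≢ 2 → CongMod p x' x →
  NoVisibleRoots p x x' → Characteristic p x x' ξ → dot ξ ξ < + (n ℕ.* p ℕ.* p) →
  4 ℕ.* (n ℕ.* n ℕ.* n) ℕ.≤ 3 ℕ.* norm² ξ ℕ.+ n
characteristic-norm-bound {p = p} {x} {x'} {ξ} p-prime p≢2 x'≡x noRoots
                          char@((m , k , _ , ξ≡pm+kx') , _) short =
  distinct-odd-squares _ ξ-odd (∣ξ∣-injective {x = x} p-prime noRoots x'≡x ξ≡pm+kx' p∤k)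
  where
  ξ-odd : ∀ i → ¬ 2 ∣ℕ ∣ ξ i ∣
  ξ-odd = characteristic⇒odd p-prime p≢2 char
  p∤k : ¬ (+ p ∣ k)
  p∤k = norm<np²⇒p∤k {m = m} {x'} {ξ} ξ≡pm+kx' ξ-odd short

cubic-bound-toℤ : ∀ n s → 4 ℕ.* (n ℕ.* n ℕ.* n) ℕ.≤ 3 ℕ.* s ℕ.+ n →
  + 4 * + n * + n * + n - + n ≤ + 3 * + s
cubic-bound-toℤ n s 4n³≤3s+n = subst₂ _≤_ (cong (_- + n) 4n³) (3s+n-n) (+-monoˡ-≤ (- + n) (ℤ.+≤+ 4n³≤3s+n))
  where
  open ≡-Reasoning
  reassoc : ∀ a b → a * (b * b * b) ≡ a * b * b * b
  reassoc = solve-∀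
  4n³ : + (4 ℕ.* (n ℕ.* n ℕ.* n)) ≡ + 4 * + n * + n * + n
  4n³ = begin
    + (4 ℕ.* (n ℕ.* n ℕ.* n))   ≡⟨ pos-* 4 (n ℕ.* n ℕ.* n) ⟩
    + 4 * + (n ℕ.* n ℕ.* n)     ≡⟨ cong (+ 4 *_) (trans (pos-* (n ℕ.* n) n) (cong (_* + n) (pos-* n n))) ⟩
    + 4 * (+ n * + n * + n)     ≡⟨ reassoc (+ 4) (+ n) ⟩
    + 4 * + n * + n * + n       ∎
  cancel : ∀ a b → a + b - b ≡ a
  cancel = solve-∀
  3s+n-n : + (3 ℕ.* s ℕ.+ n) - + n ≡ + 3 * + s
  3s+n-n = begin
    + (3 ℕ.* s ℕ.+ n) - + n     ≡⟨ cong (_- + n) (trans (pos-+ (3 ℕ.* s) n) (cong (_+ + n) (pos-* 3 s))) ⟩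
    + 3 * + s + + n - + n       ≡⟨ cancel (+ 3 * + s) (+ n) ⟩
    + 3 * + s                   ∎

lemma6p3 : (n : ℕ) → 1 ℕ.≤ n → (p : ℕ) → Prime p →
    (x x' : Vecℤ n) → CoprimeCoords x → CongMod p x' x →
    Integral p x x' → NoVisibleRoots p x x' →
    (ξ : Vecℤ n) → Characteristic p x x' ξ →
    dot ξ ξ < + (n ℕ.* p ℕ.* p) →
    + 4 * + n * + n * + n - + n ≤ + 3 * dot ξ ξ
lemma6p3 n _ p p-prime x x' coprime x'≡x integral noRoots ξ char short with p ℕ.≟ 2
... | yes refl = ⊥-elim (noVisibleRoots₂⇒⊥ coprime x'≡x integral noRoots)
... | no p≢2 = subst (λ t → + 4 * + n * + n * + n - + n ≤ + 3 * t) (sym (dot-self ξ))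
  (cubic-bound-toℤ n (norm² ξ) (characteristic-norm-bound p-prime p≢2 x'≡x noRoots char short))
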